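{- Let $\mathfrak K_1$ and $\mathfrak K_2$ be $\mathscr T$-based orthomodular dynamic algebras and let $\phi:\mathfrak K_1\to\mathfrak K_2$ be a bijective morphism of involutive generalized dynamic algebras. Then the restriction $\widetilde\phi$ of $\phi$ to $\widetilde K_1$ is an ortholattice isomorphism from $(\widetilde K_1,\preceq_1,{}^{\perp_1})$ onto $(\widetilde K_2,\preceq_2,{}^{\perp_2})$.
   Context: A unital involutive quantale $(K,\bigsqcup,\odot,{}^*,e)$: complete join-semilattice (binary join $\sqcup$), associative $\odot$ distributing over arbitrary joins on both sides, unit $e$, involution with $x^{**}=x$, $(x\odot y)^*=y^*\odot x^*$, $(\bigsqcup x_i)^*=\bigsqcup x_i^*$. An involutive generalized dynamic algebra (IDA) is $(K,\bigsqcup,\odot,{}^*,{\sim},e)$ with such a quantale and ${\sim}:K\to K$ satisfying for all $x,y$ and families $(x_i)$: ${\sim}(x\odot{\sim}{\sim}y)={\sim}(x\odot y)$; ${\sim}(\bigsqcup_i{\sim}{\sim}x_i)={\sim}(\bigsqcup_ix_i)$; $({\sim}x)^*={\sim}x$; ${\sim}{\sim}({\sim}{\sim}x\odot y)={\sim}({\sim}x\sqcup{\sim}({\sim}x\sqcup y))$. Notation: $\widetilde K=\{{\sim}k\}$; $\bigvee W={\sim}{\sim}\bigsqcup W$; $k\preceq l$ iff $\bigvee\{k,l\}=l$; $w^\perp={\sim}w$; $k\bullet v={\sim}{\sim}(k\odot v)$; $k\equiv l$ iff $k\bullet w=l\bullet w$ for all $w\in\widetilde K$. IDA morphisms preserve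 arbitrary joins, $\odot$, unit, ${}^*$, ${\sim}$. Semi-Foulis: $(\widetilde K,\preceq,{}^\perp)$ is a complete orthomodular lattice (OML). For a complete OML $\mathcal M$ with Sasaki projections $\pi_m(x)=m\wedge(m^\perp\vee x)$, $\mathbf{Lin}(\mathcal M)$ is the set of maps $f:M\to M$ admitting $f^*$ with $f(x)\le y^\perp\iff x\le f^*(y)^\perp$, with pointwise joins, $\odot=\circ$, involution $f^*$, unit $\mathrm{id}_M$, ${\sim}f=\pi_{f(1)^\perp}$ (an IDA). For an involutive submonoid $L\subseteq\mathbf{Lin}(\mathcal M)$ containing all $\pi_m$, $\mathscr P(L)$ is the IDA of subsets of $L$ with union, $A\odot B=\{a\circ b\}$, $A^*=\{a^*\}$, ${\sim}A=\{\pi_{(\bigvee_{a\in A}a(1))^\perp}\}$, unit $\{\mathrm{id}_M\}$. $\mathbb{IM}$: involutive monoids with maps preserving product, unit, involution. Fix a functor $\mathscr T$ from IDAs to $\mathbb{IM}$ with: (T1) $\widetilde K\subseteq\mathscr T(K)\subseteq K$, $\mathscr T(K)$ an involutive submonoid; (T2) for every semi-Foulis $\mathfrak K$ with $s=t\iff s\equiv t$ on $\mathscr T(K)$, $\nu_{\mathfrak K}(k)=k\bullet(-)$ is an $\mathbb{IM}$-isomorphism $\mathscr T(\mathfrak K)\to\mathscr T(\mathbf{Lin}(\widetilde K,\preceq,{}^\perp))$; (T3) for every complete OML $\mathcal M$, $f\mapsto\{f\}$ is an $\mathbb{IM}$-isomorphism $\mathscr T(\mathbf{Lin}(\mathcal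 M))\to\mathscr T(\mathscr P(\mathscr T(\mathbf{Lin}(\mathcal M))))$; (T4) $\mathscr T(f)$ is the restriction of $f$. A $\mathscr T$-based orthomodular dynamic algebra is an IDA with: (TODA1) $(\widetilde K,\preceq,{}^\perp)$ complete OML; (TODA2) any $A$ with $\mathscr T(K)\subseteq A\subseteq K$ closed under $\odot$, ${}^*$, arbitrary joins equals $K$; (TODA3) for $S,T\subseteq\mathscr T(K)$, $\bigsqcup S=\bigsqcup T$ iff $S=T$; (TODA4) for $s,t\in\mathscr T(K)$, $s=t$ iff $s\equiv t$. An ortholattice isomorphism $g$ is a bijection with $m\le n\iff g(m)\le g(n)$ and $g(m^\perp)=g(m)^\perp$. -}

module Defs where

import Level
open import Level using (Level; suc; _⊔_)
open import Data.Bool using (Bool; true; false)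
open import Data.Product using (Σ; ∃; _×_; _,_; proj₁)
open import Function.Bundles using (_⇔_)
open import Relation.Binary.PropositionalEquality using (_≡_)

-- Complete join-semilattice presented by a partial order and a join
-- of every family indexed by a type in Set ℓ (subsets of K are the
-- special case of families Σ K S → K given by proj₁).
record Quantale (ℓ : Level) : Set (suc ℓ) where
  infixl 7 _⊙_
  field
    Carrier : Set ℓ
    _≤_     : Carrier → Carrier → Set ℓ
    ≤-refl    : ∀ {x} → x ≤ x
    ≤-trans   : ∀ {x y z} → x ≤ y → y ≤ z → x ≤ z
    ≤-antisym : ∀ {x y} → x ≤ y → y ≤ x → x ≡ y
    ⨆       : {I : Set ℓ} → (I → Carrier) → Carrier
    ⨆-upper : ∀ {I : Set ℓ} (f : I → Carrier) (i : I) → f i ≤ ⨆ f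
    ⨆-least : ∀ {I : Set ℓ} (f : I → Carrier) (u : Carrier) →
              (∀ i → f i ≤ u) → ⨆ f ≤ u
    _⊙_     : Carrier → Carrier → Carrier
    e       : Carrier
    _*      : Carrier → Carrier
    ⊙-assoc : ∀ x y z → (x ⊙ y) ⊙ z ≡ x ⊙ (y ⊙ z)
    ⊙-identityˡ : ∀ x → e ⊙ x ≡ x
    ⊙-identityʳ : ∀ x → x ⊙ e ≡ x
    ⊙-distribˡ-⨆ : ∀ {I : Set ℓ} x (f : I → Carrier) →
                   x ⊙ ⨆ f ≡ ⨆ (λ i → x ⊙ f i)
    ⊙-distribʳ-⨆ : ∀ {I : Set ℓ} x (f : I → Carrier) →
                   ⨆ f ⊙ x ≡ ⨆ (λ i → f i ⊙ x)
    *-involutive : ∀ x → (x *) * ≡ x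
    *-⊙          : ∀ x y → (x ⊙ y) * ≡ (y *) ⊙ (x *)
    *-⨆          : ∀ {I : Set ℓ} (f : I → Carrier) → (⨆ f) * ≡ ⨆ (λ i → f i *)

  _⊔ᵏ_ : Carrier → Carrier → Carrier
  x ⊔ᵏ y = ⨆ {Level.Lift ℓ Bool} (λ { (Level.lift true) → x ; (Level.lift false) → y })

record IDA (ℓ : Level) : Set (suc ℓ) where
  field
    quantale : Quantale ℓ
  open Quantale quantale public
  field
    ∼ : Carrier → Carrier
    ∼-⊙   : ∀ x y → ∼ (x ⊙ ∼ (∼ y)) ≡ ∼ (x ⊙ y)
    ∼-⨆   : ∀ {I : Set ℓ} (f : I → Carrier) →
            ∼ (⨆ (λ i → ∼ (∼ (f i)))) ≡ ∼ (⨆ f)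
    ∼-*   : ∀ x → (∼ x) * ≡ ∼ x
    ∼-mix : ∀ x y → ∼ (∼ (∼ (∼ x) ⊙ y)) ≡ ∼ (∼ x ⊔ᵏ ∼ (∼ x ⊔ᵏ y))

  IsTilde : Carrier → Set ℓ
  IsTilde k = ∃ λ l → k ≡ ∼ l

  ⋁ : (Carrier → Set ℓ) → Carrier
  ⋁ W = ∼ (∼ (⨆ {Σ Carrier W} proj₁))

  _⪯_ : Carrier → Carrier → Set ℓ
  k ⪯ l = ∼ (∼ (k ⊔ᵏ l)) ≡ l

  _⊥ : Carrier → Carrier
  w ⊥ = ∼ w

  _•_ : Carrier → Carrier → Carrier
  k • v = ∼ (∼ (k ⊙ v))

  -- k ≡ l in the sense of the paper
  _≋_ : Carrier → Carrier → Set ℓ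
  k ≋ l = ∀ w → IsTilde w → k • w ≡ l • w

record IsIDAMorphism {ℓ : Level} (A B : IDA ℓ) (φ : IDA.Carrier A → IDA.Carrier B) : Set (suc ℓ) where
  private
    module A = IDA A
    module B = IDA B
  field
    pres-⨆ : ∀ {I : Set ℓ} (f : I → A.Carrier) → φ (A.⨆ f) ≡ B.⨆ (λ i → φ (f i))
    pres-⊙ : ∀ x y → φ (x A.⊙ y) ≡ φ x B.⊙ φ y
    pres-e : φ A.e ≡ B.e
    pres-* : ∀ x → φ (x A.*) ≡ (φ x) B.*
    pres-∼ : ∀ x → φ (A.∼ x) ≡ B.∼ (φ x)

Bijective : {a b : Level} {X : Set a} {Y : Set b} → (X → Y) → Set (a ⊔ b)
Bijective {X = X} {Y} f = (∀ x y → f x ≡ f y → x ≡ y) × (∀ y → ∃ λ x → f x ≡ y)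

module _ {a : Level} {X : Set a} (P : X → Set a) (_≤_ : X → X → Set a) where

  IsLub : (X → Set a) → X → Set a
  IsLub S s = P s × (∀ x → S x → x ≤ s) × (∀ u → P u → (∀ x → S x → x ≤ u) → s ≤ u)

  Pair : X → X → X → Set a
  Pair x y z = (z ≡ x) Data.Sum.⊎ (z ≡ y)
    where import Data.Sum

  IsCompleteOML : (X → X) → Set (Level.suc a)
  IsCompleteOML c =
      (∀ {x} → P x → x ≤ x)
    × (∀ {x y} → P x → P y → x ≤ y → y ≤ x → x ≡ y)
    × (∀ {x y z} → P x → P y → P z → x ≤ y → y ≤ z → x ≤ z)
    × (∀ (S : X → Set a) → (∀ x → S x → P x) → ∃ λ s → IsLub S s)
    × (∀ {x} → P x → P (c x))
    × (∀ {x} → P x → c (c x) ≡ x)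
    × (∀ {x y} → P x → P y → x ≤ y → c y ≤ c x)
    × (∀ {x j y} → P x → IsLub (Pair x (c x)) j → P y → y ≤ j)
    -- orthomodular law:  x ≤ y  ⇒  y = x ∨ (y ∧ x⊥),  with y ∧ x⊥ = (y⊥ ∨ x)⊥
    × (∀ {x y j₁ j₂} → P x → P y → x ≤ y →
         IsLub (Pair (c y) x) j₁ → IsLub (Pair x (c j₁)) j₂ → y ≡ j₂)

-- The fixed functor 𝒯 (only (T1) and (T4) are recorded)
record TFunctor (ℓ : Level) : Set (suc ℓ) where
  field
    𝒯 : (A : IDA ℓ) → IDA.Carrier A → Set ℓ
    T1-tilde : (A : IDA ℓ) → ∀ k → IDA.IsTilde A k → 𝒯 A k
    T1-⊙ : (A : IDA ℓ) → ∀ k l → 𝒯 A k → 𝒯 A l → 𝒯 A (IDA._⊙_ A k l)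
    T1-e : (A : IDA ℓ) → 𝒯 A (IDA.e A)
    T1-* : (A : IDA ℓ) → ∀ k → 𝒯 A k → 𝒯 A (IDA._* A k)
    -- (T4): 𝒯(f) is the restriction of f (so f maps 𝒯(A) into 𝒯(B))
    T4 : (A B : IDA ℓ) (f : IDA.Carrier A → IDA.Carrier B) →
         IsIDAMorphism A B f → ∀ k → 𝒯 A k → 𝒯 B (f k)

record IsTODA {ℓ : Level} (T : TFunctor ℓ) (K : IDA ℓ) : Set (suc ℓ) where
  open IDA K
  open TFunctor T
  field
    TODA1 : IsCompleteOML IsTilde _⪯_ _⊥
    TODA2 : (A : Carrier → Set ℓ) →
            (∀ k → 𝒯 K k → A k) →
            (∀ k l → A k → A l → A (k ⊙ l)) →
            (∀ k → A k → A (k *)) →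
            (∀ {I : Set ℓ} (f : I → Carrier) → (∀ i → A (f i)) → A (⨆ f)) →
            ∀ k → A k
    TODA3 : (S T′ : Carrier → Set ℓ) →
            (∀ k → S k → 𝒯 K k) → (∀ k → T′ k → 𝒯 K k) →
            (⨆ {Σ Carrier S} proj₁ ≡ ⨆ {Σ Carrier T′} proj₁) ⇔ (∀ k → (S k ⇔ T′ k))
    TODA4 : ∀ s t → 𝒯 K s → 𝒯 K t → (s ≡ t) ⇔ (s ≋ t)

record IsOrthoIso {ℓ : Level} (K₁ K₂ : IDA ℓ) (g : IDA.Carrier K₁ → IDA.Carrier K₂) : Set ℓ where
  private
    module A = IDA K₁
    module B = IDA K₂
  field
    maps-into : ∀ m → A.IsTilde m → B.IsTilde (g m)
    injective : ∀ m n → A.IsTilde m → A.IsTilde n → g m ≡ g n → m ≡ n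
    surjective : ∀ v → B.IsTilde v → ∃ λ m → A.IsTilde m × g m ≡ v
    order : ∀ m n → A.IsTilde m → A.IsTilde n → (m A.⪯ n) ⇔ (g m B.⪯ g n)
    pres-⊥ : ∀ m → A.IsTilde m → g (m A.⊥) ≡ (g m) B.⊥

-- Everything in the ortholattice (K̃, ⪯, ⊥) is defined from ∼ and binary
-- joins, both of which an IDA morphism preserves; so φ maps K̃₁ into K̃₂,
-- preserves ⪯ and ⊥, and reflects ⪯ by injectivity, while surjectivity
-- onto K̃₂ follows from φ (∼ x) = ∼ (φ x).
module Submission where

open import Level using (Level; lift)
open import Defs
open import Data.Bool using (true; false)
open import Data.Product using (∃; _×_; _,_)
open import Function.Bundles using (mk⇔)
open import Relation.Binary.PropositionalEquality

module QuantaleProperties {ℓ : Level} (Q : Quantale ℓ) where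
  open Quantale Q

  ⨆-cong : ∀ {I : Set ℓ} {f g : I → Carrier} → (∀ i → f i ≡ g i) → ⨆ f ≡ ⨆ g
  ⨆-cong {f = f} {g} f≗g = ≤-antisym
    (⨆-least f (⨆ g) λ i → subst (_≤ ⨆ g) (sym (f≗g i)) (⨆-upper g i))
    (⨆-least g (⨆ f) λ i → subst (_≤ ⨆ f) (f≗g i) (⨆-upper f i))

module IDAMorphismProperties {ℓ : Level} {K₁ K₂ : IDA ℓ}
    {φ : IDA.Carrier K₁ → IDA.Carrier K₂} (mor : IsIDAMorphism K₁ K₂ φ) where
  private
    module A = IDA K₁
    module B = IDA K₂
  open IsIDAMorphism mor
  open QuantaleProperties B.quantale using (⨆-cong)

  pres-⊔ᵏ : ∀ m n → φ (m A.⊔ᵏ n) ≡ φ m B.⊔ᵏ φ n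
  pres-⊔ᵏ m n = trans (pres-⨆ _) (⨆-cong λ { (lift true) → refl ; (lift false) → refl })

  pres-∼∼⊔ᵏ : ∀ m n → φ (A.∼ (A.∼ (m A.⊔ᵏ n))) ≡ B.∼ (B.∼ (φ m B.⊔ᵏ φ n))
  pres-∼∼⊔ᵏ m n = begin
    φ (A.∼ (A.∼ (m A.⊔ᵏ n)))   ≡⟨ pres-∼ _ ⟩
    B.∼ (φ (A.∼ (m A.⊔ᵏ n)))   ≡⟨ cong B.∼ (pres-∼ _) ⟩
    B.∼ (B.∼ (φ (m A.⊔ᵏ n)))   ≡⟨ cong (λ z → B.∼ (B.∼ z)) (pres-⊔ᵏ m n) ⟩
    B.∼ (B.∼ (φ m B.⊔ᵏ φ n))   ∎
    where open ≡-Reasoning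

  pres-IsTilde : ∀ m → A.IsTilde m → B.IsTilde (φ m)
  pres-IsTilde _ (l , refl) = φ l , pres-∼ l

  pres-⪯ : ∀ {m n} → m A.⪯ n → φ m B.⪯ φ n
  pres-⪯ {m} {n} m⪯n = trans (sym (pres-∼∼⊔ᵏ m n)) (cong φ m⪯n)

  reflects-⪯ : (∀ x y → φ x ≡ φ y → x ≡ y) → ∀ {m n} → φ m B.⪯ φ n → m A.⪯ n
  reflects-⪯ injective {m} {n} φm⪯φn = injective _ _ (trans (pres-∼∼⊔ᵏ m n) φm⪯φn)

  IsTilde-surjective : (∀ y → ∃ λ x → φ x ≡ y) →
                       ∀ v → B.IsTilde v → ∃ λ m → A.IsTilde m × φ m ≡ v
  IsTilde-surjective surjective _ (l , refl) with surjective l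
  ... | x , φx≡l = A.∼ x , (x , refl) , trans (pres-∼ x) (cong B.∼ φx≡l)

  bijective⇒orthoIso : Bijective φ → IsOrthoIso K₁ K₂ φ
  bijective⇒orthoIso (injective , surjective) = record
    { maps-into  = pres-IsTilde
    ; injective  = λ m n _ _ → injective m n
    ; surjective = IsTilde-surjective surjective
    ; order      = λ _ _ _ _ → mk⇔ pres-⪯ (reflects-⪯ injective)
    ; pres-⊥     = λ m _ → pres-∼ m
    }

lemma4p7 : {ℓ : Level} (T : TFunctor ℓ) (K₁ K₂ : IDA ℓ) →
    IsTODA T K₁ → IsTODA T K₂ →
    (φ : IDA.Carrier K₁ → IDA.Carrier K₂) →
    IsIDAMorphism K₁ K₂ φ → Bijective φ →
    IsOrthoIso K₁ K₂ φ
lemma4p7 _ _ _ _ _ _ mor = IDAMorphismProperties.bijective⇒orthoIso mor
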